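{- For every natural number $m$ with $11 \nmid m$, the number $88m$ is a Zumkeller number.
   Context: A natural number $n$ is a Zumkeller number if the set of its positive divisors can be partitioned into two subsets with equal sums. -}

module Defs where

open import Data.Nat using (ℕ; suc; _+_)
open import Data.Nat.Divisibility using (_∣_; _∣?_)
open import Data.List using (List; filter; upTo; map; _++_)
open import Data.Nat.ListAction using (sum)
open import Data.List.Relation.Binary.Permutation.Propositional using (_↭_)
open import Data.Product using (Σ; _×_; ∃₂)
open import Relation.Binary.PropositionalEquality using (_≡_)

divisors : ℕ → List ℕ
divisors n = filter (λ d → d ∣? n) (map suc (upTo n))

Zumkeller : ℕ → Set
Zumkeller n = ∃₂ λ (A B : List ℕ) → ((A ++ B) ↭ divisors n) × (sum A ≡ sum B)

-- Write 88m = 11 · 8m and let O and E be the odd and the even divisors of m,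
-- with o = Σ O.  Since 11 ∤ 8m, the divisors of 88m are D(8m) ⊎ 11·D(8m).
-- Splitting off the prime 2 twice gives D(4m) = O ⊎ 2O ⊎ 4E ⊎ 4O (the odd
-- divisors of 2m being those of m), and likewise σ(8m) = o + 2σ(4m).  Let T
-- be the divisors of 8m not dividing 4m; then D(8m) = D(4m) ⊎ T, so
-- Σ T = o + σ(4m).  Hence
--   left = 11·T ⊎ 2O ⊎ 4E   and   right = T ⊎ 11·D(4m) ⊎ O ⊎ 4O
-- partition D(88m), and Σ left − Σ right = 10 (Σ T − σ(4m) − o) = 0.
module Submission where

open import Defs
import Algebra.Solver.CommutativeMonoid
open import Data.List using (List; []; _∷_; _++_; filter; map; upTo)
open import Data.List.Properties using (filter-all; map-++; map-∘; map-cong; partition-defn)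
open import Data.List.Membership.Propositional using (_∈_)
open import Data.List.Membership.Propositional.Properties
  using (∈-filter⁺; ∈-filter⁻; ∈-map⁺; ∈-map⁻; ∈-upTo⁺; ∈-++⁺ˡ; ∈-++⁺ʳ; ∈-++⁻)
open import Data.List.Membership.Propositional.Properties.WithK using (unique∧set⇒bag)
open import Data.List.Relation.Binary.BagAndSetEquality using (∼bag⇒↭)
open import Data.List.Relation.Binary.Disjoint.Propositional using (Disjoint)
open import Data.List.Relation.Binary.Permutation.Propositional
  using (_↭_; ↭-refl; ↭-trans; ↭-sym; ↭-reflexive; ↭ₛ⇒↭; module PermutationReasoning)
open import Data.List.Relation.Binary.Permutation.Propositional.Properties
  using (++⁺ʳ; ++⁺ˡ; ++⁺; map⁺; ++-commutativeMonoid)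
import Data.List.Relation.Binary.Permutation.Setoid.Properties as PermutationSetoid
open import Data.List.Relation.Unary.All as All using ()
open import Data.List.Relation.Unary.Unique.Propositional using (Unique)
import Data.List.Relation.Unary.Unique.Propositional.Properties as Unique
open import Data.Nat using (ℕ; zero; suc; _+_; _*_; NonZero)
open import Data.Nat.Coprimality using (Coprime; coprime-divisor)
open import Data.Nat.Divisibility
  using (_∣_; _∣?_; divides; ∣-trans; ∣⇒≤; 0∣⇒≡0; m∣m*n; n∣m*n; *-monoʳ-∣; *-monoˡ-∣; *-cancelˡ-∣)
open import Data.Nat.ListAction using (sum)
open import Data.Nat.ListAction.Properties using (sum-++; sum-↭)
open import Data.Nat.Primality using (Prime; prime?; prime⇒irreducible; prime⇒nonZero; euclidsLemma)
open import Data.Nat.Properties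
  using (suc-injective; *-comm; *-assoc; *-zeroʳ; *-distribˡ-+; *-cancelˡ-≡; +-cancelˡ-≡; m*n≢0)
open import Data.Nat.Tactic.RingSolver using (solve-∀)
open import Data.Product using (_×_; _,_; proj₁; proj₂)
open import Data.Sum using (inj₁; inj₂)
open import Function.Base using (_∘_)
open import Function.Bundles using (_⇔_; mk⇔)
open import Relation.Nullary using (¬_; yes; no; contradiction)
open import Relation.Nullary.Decidable using (from-yes; from-no)
open import Relation.Unary using (Pred; Decidable)
open import Relation.Unary.Properties using (∁?)
open import Relation.Binary.PropositionalEquality
  using (_≡_; refl; sym; trans; cong; cong₂; subst; setoid; module ≡-Reasoning)

module _ {A : Set} where

  unique-⇔⇒↭ : {xs ys : List A} → Unique xs → Unique ys → (∀ {x} → x ∈ xs ⇔ x ∈ ys) → xs ↭ ys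
  unique-⇔⇒↭ uxs uys xs⇔ys = ∼bag⇒↭ (unique∧set⇒bag uxs uys xs⇔ys)

  filter-∁-↭ : ∀ {ℓ} {P : Pred A ℓ} (P? : Decidable P) xs → xs ↭ filter P? xs ++ filter (∁? P?) xs
  filter-∁-↭ P? xs = subst (λ (ys , zs) → xs ↭ ys ++ zs) (partition-defn P? xs)
    (↭ₛ⇒↭ (PermutationSetoid.partition-↭ (setoid A) P? xs))

sum-map-* : ∀ k xs → sum (map (k *_) xs) ≡ k * sum xs
sum-map-* k []       = sym (*-zeroʳ k)
sum-map-* k (x ∷ xs) = trans (cong (k * x +_) (sum-map-* k xs)) (sym (*-distribˡ-+ k x (sum xs)))

map-*-∘ : ∀ k l xs → map (k *_) (map (l *_) xs) ≡ map ((k * l) *_) xs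
map-*-∘ k l xs = trans (sym (map-∘ xs)) (map-cong (λ x → sym (*-assoc k l x)) xs)

prime-2 : Prime 2
prime-2 = from-yes (prime? 2)

prime-11 : Prime 11
prime-11 = from-yes (prime? 11)

prime∤⇒coprime : ∀ {p n} → Prime p → ¬ p ∣ n → Coprime n p
prime∤⇒coprime pp p∤n (d∣n , d∣p) with prime⇒irreducible pp d∣p
... | inj₁ d≡1 = d≡1
... | inj₂ refl = contradiction d∣n p∤n

prime∤-* : ∀ {p} a b → Prime p → ¬ p ∣ a → ¬ p ∣ b → ¬ p ∣ a * b
prime∤-* a b pp p∤a p∤b p∣ab with euclidsLemma a b pp p∣ab
... | inj₁ p∣a = p∤a p∣a
... | inj₂ p∣b = p∤b p∣b

∣⇒nonZero : ∀ {d n} .{{_ : NonZero n}} → d ∣ n → NonZero d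
∣⇒nonZero {zero} {suc _} 0∣n with () ← 0∣⇒≡0 0∣n
∣⇒nonZero {suc _}        _   = _

divisors-unique : ∀ n → Unique (divisors n)
divisors-unique n = Unique.filter⁺ (_∣? n) (Unique.map⁺ suc-injective (Unique.upTo⁺ n))

∈-divisors⁻ : ∀ {d n} → d ∈ divisors n → d ∣ n
∈-divisors⁻ {n = n} d∈ = proj₂ (∈-filter⁻ (_∣? n) {xs = map suc (upTo n)} d∈)

∈-divisors⁺ : ∀ {d n} .{{_ : NonZero n}} → d ∣ n → d ∈ divisors n
∈-divisors⁺ {zero}  {suc _} 0∣n with () ← 0∣⇒≡0 0∣n
∈-divisors⁺ {suc d} {n}     d∣n = ∈-filter⁺ (_∣? n) (∈-map⁺ suc (∈-upTo⁺ (∣⇒≤ d∣n))) d∣n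

σ : ℕ → ℕ
σ n = sum (divisors n)

divisors-∣-↭ : ∀ {d n} .{{_ : NonZero n}} → d ∣ n →
               divisors n ↭ divisors d ++ filter (∁? (_∣? d)) (divisors n)
divisors-∣-↭ {d} {n} d∣n = ↭-trans (filter-∁-↭ (_∣? d) (divisors n))
  (++⁺ʳ _ (unique-⇔⇒↭ (Unique.filter⁺ (_∣? d) (divisors-unique n)) (divisors-unique d) (mk⇔
    (λ e∈ → ∈-divisors⁺ {{∣⇒nonZero d∣n}} (proj₂ (∈-filter⁻ (_∣? d) {xs = divisors n} e∈)))
    (λ e∈ → let e∣d = ∈-divisors⁻ e∈ in ∈-filter⁺ (_∣? d) (∈-divisors⁺ (∣-trans e∣d d∣n)) e∣d))))

coprimeDivisors : ℕ → ℕ → List ℕ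
coprimeDivisors p n = filter (∁? (p ∣?_)) (divisors n)

coprimeDivisors-unique : ∀ p n → Unique (coprimeDivisors p n)
coprimeDivisors-unique p n = Unique.filter⁺ (∁? (p ∣?_)) (divisors-unique n)

∈-coprimeDivisors⁻ : ∀ {p n d} → d ∈ coprimeDivisors p n → d ∣ n × ¬ p ∣ d
∈-coprimeDivisors⁻ {p} {n} d∈ with ∈-filter⁻ (∁? (p ∣?_)) {xs = divisors n} d∈
... | d∈D , p∤d = ∈-divisors⁻ d∈D , p∤d

∈-coprimeDivisors⁺ : ∀ {p n d} .{{_ : NonZero n}} → d ∣ n → ¬ p ∣ d → d ∈ coprimeDivisors p n
∈-coprimeDivisors⁺ {p} d∣n p∤d = ∈-filter⁺ (∁? (p ∣?_)) (∈-divisors⁺ d∣n) p∤d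

coprimeDivisors-of-∤ : ∀ {p n} → ¬ p ∣ n → coprimeDivisors p n ≡ divisors n
coprimeDivisors-of-∤ {p} p∤n =
  filter-all (∁? (p ∣?_)) (All.tabulate (λ d∈ p∣d → p∤n (∣-trans p∣d (∈-divisors⁻ d∈))))

module _ {p : ℕ} (pp : Prime p) (n : ℕ) .{{_ : NonZero n}} where

  private
    instance
      p≢0  = prime⇒nonZero pp
      pn≢0 = m*n≢0 p n

    C pD : List ℕ
    C  = coprimeDivisors p n
    pD = map (p *_) (divisors n)

    ∣p*n⇒ : ∀ {d} → d ∣ p * n → d ∈ C ++ pD
    ∣p*n⇒ {d} d∣pn with p ∣? d
    ... | no p∤d = ∈-++⁺ˡ (∈-coprimeDivisors⁺ (coprime-divisor (prime∤⇒coprime pp p∤d) d∣pn) p∤d)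
    ... | yes (divides q refl) = ∈-++⁺ʳ C (subst (_∈ pD) (*-comm p q)
            (∈-map⁺ (p *_) (∈-divisors⁺ (*-cancelˡ-∣ p (subst (_∣ p * n) (*-comm q p) d∣pn)))))

    ⇒∣p*n : ∀ {d} → d ∈ C ++ pD → d ∣ p * n
    ⇒∣p*n d∈ with ∈-++⁻ C d∈
    ... | inj₁ d∈C = ∣-trans (proj₁ (∈-coprimeDivisors⁻ {p} {n} d∈C)) (n∣m*n p)
    ... | inj₂ d∈pD with ∈-map⁻ (p *_) d∈pD
    ...   | e , e∈D , refl = *-monoʳ-∣ p (∈-divisors⁻ e∈D)

    C-pD-disjoint : Disjoint C pD
    C-pD-disjoint (d∈C , d∈pD) with ∈-map⁻ (p *_) d∈pD
    ... | e , _ , refl = proj₂ (∈-coprimeDivisors⁻ {p} {n} d∈C) (m∣m*n e)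

  divisors-*-prime : divisors (p * n) ↭ coprimeDivisors p n ++ map (p *_) (divisors n)
  divisors-*-prime = unique-⇔⇒↭ (divisors-unique (p * n))
    (Unique.++⁺ (coprimeDivisors-unique p n) (Unique.map⁺ (*-cancelˡ-≡ _ _ p) (divisors-unique n)) C-pD-disjoint)
    (mk⇔ (∣p*n⇒ ∘ ∈-divisors⁻) (∈-divisors⁺ ∘ ⇒∣p*n))

  coprimeDivisors-*-prime : coprimeDivisors p (p * n) ↭ coprimeDivisors p n
  coprimeDivisors-*-prime = unique-⇔⇒↭ (coprimeDivisors-unique p (p * n)) (coprimeDivisors-unique p n) (mk⇔
    (λ d∈ → let d∣pn , p∤d = ∈-coprimeDivisors⁻ {p} {p * n} d∈ in
            ∈-coprimeDivisors⁺ (coprime-divisor (prime∤⇒coprime pp p∤d) d∣pn) p∤d)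
    (λ d∈ → let d∣n , p∤d = ∈-coprimeDivisors⁻ {p} {n} d∈ in
            ∈-coprimeDivisors⁺ (∣-trans d∣n (n∣m*n p)) p∤d))

  σ-*-prime : σ (p * n) ≡ sum (coprimeDivisors p n) + p * σ n
  σ-*-prime = trans (sum-↭ divisors-*-prime)
    (trans (sum-++ C pD) (cong (sum C +_) (sum-map-* p (divisors n))))

balance : ∀ {t s o e} → t ≡ o + s → s ≡ o + (2 * o + (4 * e + 4 * o)) →
          11 * t + (2 * o + 4 * e) ≡ t + (11 * s + (o + 4 * o))
balance {o = o} {e} refl refl = identity o e
  where
  identity : ∀ o e → let s = o + (2 * o + (4 * e + 4 * o)) in
             11 * (o + s) + (2 * o + 4 * e) ≡ (o + s) + (11 * s + (o + 4 * o))
  identity = solve-∀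

module _ (m : ℕ) .{{_ : NonZero m}} where

  private instance
    2m≢0 = m*n≢0 2 m
    4m≢0 = m*n≢0 4 m
    8m≢0 = m*n≢0 8 m

  odd even top : List ℕ
  odd  = coprimeDivisors 2 m
  even = filter (2 ∣?_) (divisors m)
  top  = filter (∁? (_∣? 4 * m)) (divisors (8 * m))

  left right : List ℕ
  left  = map (11 *_) top ++ (map (2 *_) odd ++ map (4 *_) even)
  right = top ++ (map (11 *_) (divisors (4 * m)) ++ (coprimeDivisors 2 (2 * m) ++ map (4 *_) odd))

  divisors-8m-↭ : divisors (8 * m) ↭ divisors (4 * m) ++ top
  divisors-8m-↭ = divisors-∣-↭ (*-monoˡ-∣ {4} {8} m (divides 2 refl))

  divisors-4m-↭ : divisors (4 * m) ↭
                  coprimeDivisors 2 (2 * m) ++ (map (2 *_) odd ++ (map (4 *_) even ++ map (4 *_) odd))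
  divisors-4m-↭ = begin
    divisors (4 * m)                                             ≡⟨ cong divisors (*-assoc 2 2 m) ⟩
    divisors (2 * (2 * m))                                       ↭⟨ divisors-*-prime prime-2 (2 * m) ⟩
    O₂ ++ map (2 *_) (divisors (2 * m))                          ↭⟨ ++⁺ˡ O₂ (map⁺ (2 *_) (divisors-*-prime prime-2 m)) ⟩
    O₂ ++ map (2 *_) (odd ++ map (2 *_) (divisors m))            ↭⟨ ++⁺ˡ O₂ (map⁺ (2 *_) (++⁺ˡ odd (map⁺ (2 *_) m-even-odd))) ⟩
    O₂ ++ map (2 *_) (odd ++ map (2 *_) (even ++ odd))           ≡⟨ cong (O₂ ++_) distribute ⟩
    O₂ ++ (map (2 *_) odd ++ (map (4 *_) even ++ map (4 *_) odd)) ∎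
    where
    open PermutationReasoning
    O₂ : List ℕ
    O₂ = coprimeDivisors 2 (2 * m)
    m-even-odd : divisors m ↭ even ++ odd
    m-even-odd = filter-∁-↭ (2 ∣?_) (divisors m)
    distribute : map (2 *_) (odd ++ map (2 *_) (even ++ odd)) ≡ map (2 *_) odd ++ (map (4 *_) even ++ map (4 *_) odd)
    distribute = trans (map-++ (2 *_) odd _)
      (cong (map (2 *_) odd ++_) (trans (map-*-∘ 2 2 (even ++ odd)) (map-++ (4 *_) even odd)))

  left++right↭divisors : ¬ 11 ∣ m → left ++ right ↭ divisors (88 * m)
  left++right↭divisors 11∤m = ↭-sym (begin
    divisors (88 * m)                                    ≡⟨ cong divisors (*-assoc 11 8 m) ⟩
    divisors (11 * (8 * m))                              ↭⟨ divisors-*-prime prime-11 (8 * m) ⟩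
    coprimeDivisors 11 (8 * m) ++ map (11 *_) D8         ≡⟨ cong (_++ map (11 *_) D8) (coprimeDivisors-of-∤ 11∤8m) ⟩
    D8 ++ map (11 *_) D8                                 ↭⟨ ++⁺ divisors-8m-↭ (map⁺ (11 *_) divisors-8m-↭) ⟩
    (D4 ++ top) ++ map (11 *_) (D4 ++ top)               ≡⟨ cong ((D4 ++ top) ++_) (map-++ (11 *_) D4 top) ⟩
    (D4 ++ top) ++ (map (11 *_) D4 ++ map (11 *_) top)   ↭⟨ ++⁺ʳ _ (++⁺ʳ top divisors-4m-↭) ⟩
    ((O₂ ++ (O×2 ++ (E×4 ++ O×4))) ++ top) ++ (D4×11 ++ top×11)
                                                         ↭⟨ rearrange O₂ O×2 E×4 O×4 top D4×11 top×11 ⟩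
    left ++ right                                        ∎)
    where
    open PermutationReasoning
    open Algebra.Solver.CommutativeMonoid (++-commutativeMonoid {A = ℕ}) using (solve; _⊜_; _⊕_)
    11∤8m : ¬ 11 ∣ 8 * m
    11∤8m = prime∤-* 8 m prime-11 (from-no (11 ∣? 8)) 11∤m
    D8 D4 O₂ O×2 O×4 E×4 D4×11 top×11 : List ℕ
    D8 = divisors (8 * m)
    D4 = divisors (4 * m)
    O₂ = coprimeDivisors 2 (2 * m)
    O×2 = map (2 *_) odd
    O×4 = map (4 *_) odd
    E×4 = map (4 *_) even
    D4×11 = map (11 *_) D4
    top×11 = map (11 *_) top
    rearrange : ∀ a b c d e f g → ((a ++ (b ++ (c ++ d))) ++ e) ++ (f ++ g) ↭ (g ++ (b ++ c)) ++ (e ++ (f ++ (a ++ d)))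
    rearrange = solve 7 (λ o₂ o2 e4 o4 t d11 t11 →
      ((o₂ ⊕ (o2 ⊕ (e4 ⊕ o4))) ⊕ t) ⊕ (d11 ⊕ t11) ⊜ (t11 ⊕ (o2 ⊕ e4)) ⊕ (t ⊕ (d11 ⊕ (o₂ ⊕ o4)))) ↭-refl

  odd-2m-↭ : coprimeDivisors 2 (2 * m) ↭ odd
  odd-2m-↭ = coprimeDivisors-*-prime prime-2 m

  odd-4m-↭ : coprimeDivisors 2 (4 * m) ↭ odd
  odd-4m-↭ = ↭-trans (↭-reflexive (cong (coprimeDivisors 2) (*-assoc 2 2 m)))
                     (↭-trans (coprimeDivisors-*-prime prime-2 (2 * m)) odd-2m-↭)

  σ-4m : σ (4 * m) ≡ sum odd + (2 * sum odd + (4 * sum even + 4 * sum odd))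
  σ-4m = begin
    σ (4 * m)                                                        ≡⟨ sum-↭ divisors-4m-↭ ⟩
    sum (O₂ ++ (map (2 *_) odd ++ (map (4 *_) even ++ map (4 *_) odd))) ≡⟨ sum-++ O₂ _ ⟩
    sum O₂ + sum (map (2 *_) odd ++ (map (4 *_) even ++ map (4 *_) odd))
      ≡⟨ cong₂ _+_ (sum-↭ odd-2m-↭) (trans (sum-++ (map (2 *_) odd) _) (cong₂ _+_ (sum-map-* 2 odd)
           (trans (sum-++ (map (4 *_) even) _) (cong₂ _+_ (sum-map-* 4 even) (sum-map-* 4 odd))))) ⟩
    sum odd + (2 * sum odd + (4 * sum even + 4 * sum odd))            ∎
    where
    open ≡-Reasoning
    O₂ : List ℕ
    O₂ = coprimeDivisors 2 (2 * m)

  sum-top : sum top ≡ sum odd + σ (4 * m)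
  sum-top = +-cancelˡ-≡ (σ (4 * m)) _ _ (begin
    σ (4 * m) + sum top                              ≡⟨ sum-++ (divisors (4 * m)) top ⟨
    sum (divisors (4 * m) ++ top)                    ≡⟨ sum-↭ divisors-8m-↭ ⟨
    σ (8 * m)                                        ≡⟨ cong σ (*-assoc 2 4 m) ⟩
    σ (2 * (4 * m))                                  ≡⟨ σ-*-prime prime-2 (4 * m) ⟩
    sum (coprimeDivisors 2 (4 * m)) + 2 * σ (4 * m)  ≡⟨ cong (_+ 2 * σ (4 * m)) (sum-↭ odd-4m-↭) ⟩
    sum odd + 2 * σ (4 * m)                          ≡⟨ regroup (sum odd) (σ (4 * m)) ⟩
    σ (4 * m) + (sum odd + σ (4 * m))                ∎)
    where
    open ≡-Reasoning
    regroup : ∀ o s → o + 2 * s ≡ s + (o + s)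
    regroup = solve-∀

  sum-left : sum left ≡ 11 * sum top + (2 * sum odd + 4 * sum even)
  sum-left = trans (sum-++ (map (11 *_) top) _) (cong₂ _+_ (sum-map-* 11 top)
    (trans (sum-++ (map (2 *_) odd) _) (cong₂ _+_ (sum-map-* 2 odd) (sum-map-* 4 even))))

  sum-right : sum right ≡ sum top + (11 * σ (4 * m) + (sum odd + 4 * sum odd))
  sum-right = trans (sum-++ top _) (cong (sum top +_)
    (trans (sum-++ (map (11 *_) (divisors (4 * m))) _) (cong₂ _+_ (sum-map-* 11 (divisors (4 * m)))
      (trans (sum-++ (coprimeDivisors 2 (2 * m)) _) (cong₂ _+_ (sum-↭ odd-2m-↭) (sum-map-* 4 odd))))))

  sum-left≡sum-right : sum left ≡ sum right
  sum-left≡sum-right = trans sum-left (trans (balance {e = sum even} sum-top σ-4m) (sym sum-right))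

lemma4p1 : (m : ℕ) → .{{_ : NonZero m}} → ¬ (11 ∣ m) → Zumkeller (88 * m)
lemma4p1 m 11∤m = left m , right m , left++right↭divisors m 11∤m , sum-left≡sum-right m
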